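{- Let $q\geq 2$, identify $Q=\{1,\ldots,q\}$, and let $T$ be a subgroup of $S_q$. Then the permutation code $C(T)$ is diagonally neighbour transitive in $H(q,q)$ if and only if the normaliser $N_{S_q}(T)=\{x\in S_q: T^x=T\}$ acts $2$-transitively on $\{1,\ldots,q\}$. Moreover, for any positive integer $p$, if $C(T)$ is diagonally neighbour transitive in $H(q,q)$, then $\mathrm{Rep}_p(C(T))$ is a diagonally neighbour transitive frequency permutation array in $H(pq,q)$.
   Context: The Hamming graph $H(m,q)$ has vertex set $Q^m$, two vertices adjacent iff they differ in exactly one entry. Its automorphism group is $B\rtimes L$ with $B\cong S_q^m$, $L\cong S_m$, where $(g_1,\ldots,g_m)\in B$ acts by $\alpha^g=(\alpha_1^{g_1},\ldots,\alpha_m^{g_m})$ and $\sigma\in L$ acts by $\alpha^\sigma=(\alpha_{1\sigma^{ -1}},\ldots,\alpha_{m\sigma^{ -1}})$; $\mathrm{Diag}_m(S_q)=\{(h,\ldots,h)\in B:h\in S_q\}$. A code is a subset $C$ of vertices; its set of neighbours $C_1$ is the set of non-codewords adjacent to some codeword. $C$ is $X$-neighbour transitive ($X$ a group of automorphisms) if $C$ and $C_1$ are both $X$-orbits, and diagonally neighbour transitive if this holds for some $X\leq\mathrm{Diag}_m(S_q)\rtimes L$. For $t\in S_q$, $\alpha(t)=(1^t,\ldots,q^t)\in V(H(q,q))$, and $C(T)=\{\alpha(t):t\in T\}$. Vertices of $H(pq,q)$ are identified with $p$-tuples of vertices of $H(q,q)$ (concatenation); for $\alpha\in V(H(q,q))$,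 $\mathrm{rep}_p(\alpha)=(\alpha,\ldots,\alpha)$ ($p$ copies), and $\mathrm{Rep}_p(C)=\{\mathrm{rep}_p(\alpha):\alpha\in C\}$. A frequency permutation array in $H(pq,q)$ is a code in which every letter of $Q$ occurs exactly $p$ times in each codeword. -}

module Defs where

open import Data.Nat using (ℕ; zero; suc; _+_; _*_)
open import Data.Fin using (Fin; _≟_)
open import Data.Fin.Permutation using (Permutation′; _⟨$⟩ʳ_; _⟨$⟩ˡ_; _∘ₚ_; flip; id)
open import Data.Vec using (Vec; []; _∷_; lookup; tabulate; concat; replicate)
open import Data.Product using (Σ; ∃; _×_; _,_)
open import Relation.Binary.PropositionalEquality using (_≡_; _≢_)
open import Relation.Nullary using (¬_; yes; no)
open import Function.Bundles using (_⇔_)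

-- The symmetric group S_n, as permutations of Q = Fin n
-- (Fin n stands for {1,...,n}).  Composition π₁ ∘ₚ π₂ applies π₁ first
-- (right-action convention, as in the paper).
Sym : ℕ → Set
Sym = Permutation′

_≈ₚ_ : ∀ {n} → Sym n → Sym n → Set
π ≈ₚ ρ = ∀ i → π ⟨$⟩ʳ i ≡ ρ ⟨$⟩ʳ i

record Subgroup (n : ℕ) : Set₁ where
  field
    mem      : Sym n → Set
    respects : ∀ {π ρ} → π ≈ₚ ρ → mem π → mem ρ
    id-mem   : mem id
    ∘-mem    : ∀ {π ρ} → mem π → mem ρ → mem (π ∘ₚ ρ)
    inv-mem  : ∀ {π} → mem π → mem (flip π)
open Subgroup public

-- Conjugate t^x = x⁻¹ t x (right actions: apply x⁻¹, then t, then x)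
conj : ∀ {n} → Sym n → Sym n → Sym n
conj x t = flip x ∘ₚ (t ∘ₚ x)

Normaliser : ∀ {n} → Subgroup n → Sym n → Set
Normaliser T x = ∀ t → (mem T t ⇔ mem T (conj x t))

TwoTransitive : ∀ {n} → (Sym n → Set) → Set
TwoTransitive {n} P =
  ∀ (a b c d : Fin n) → a ≢ b → c ≢ d →
  Σ (Sym n) λ x → P x × (x ⟨$⟩ʳ a ≡ c) × (x ⟨$⟩ʳ b ≡ d)

Vertex : ℕ → ℕ → Set
Vertex m q = Vec (Fin q) m

dist : ∀ {m q} → Vertex m q → Vertex m q → ℕ
dist [] [] = 0
dist (x ∷ xs) (y ∷ ys) with x ≟ y
... | yes _ = dist xs ys
... | no  _ = suc (dist xs ys)

Adjacent : ∀ {m q} → Vertex m q → Vertex m q → Set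
Adjacent α β = dist α β ≡ 1

Code : ℕ → ℕ → Set₁
Code m q = Vertex m q → Set

Neighbours : ∀ {m q} → Code m q → Code m q
Neighbours C β = ¬ C β × Σ _ λ α → C α × Adjacent α β

-- The group Diag_m(S_q) ⋊ L.  Since L centralises Diag_m(S_q), this group
-- is Diag_m(S_q) × L ≅ S_q × S_m; an element is a pair (h , σ) standing
-- for (h,...,h)σ, with componentwise multiplication.

DiagL : ℕ → ℕ → Set
DiagL m q = Sym q × Sym m

act : ∀ {m q} → DiagL m q → Vertex m q → Vertex m q
act (h , σ) α = tabulate λ i → h ⟨$⟩ʳ lookup α (σ ⟨$⟩ˡ i)

_≈d_ : ∀ {m q} → DiagL m q → DiagL m q → Set
(h , σ) ≈d (h′ , σ′) = h ≈ₚ h′ × σ ≈ₚ σ′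

record DiagSubgroup (m q : ℕ) : Set₁ where
  field
    dmem      : DiagL m q → Set
    drespects : ∀ {g g′} → g ≈d g′ → dmem g → dmem g′
    did-mem   : dmem (id , id)
    d∘-mem    : ∀ {h σ h′ σ′} → dmem (h , σ) → dmem (h′ , σ′) → dmem (h ∘ₚ h′ , σ ∘ₚ σ′)
    dinv-mem  : ∀ {h σ} → dmem (h , σ) → dmem (flip h , flip σ)
open DiagSubgroup public

IsOrbit : ∀ {m q} → DiagSubgroup m q → Code m q → Set
IsOrbit {m} {q} X C =
  Σ (Vertex m q) C ×
  (∀ α β → C α → (C β ⇔ Σ (DiagL m q) λ g → dmem X g × β ≡ act g α))

NeighbourTransitive : ∀ {m q} → DiagSubgroup m q → Code m q → Set
NeighbourTransitive X C = IsOrbit X C × IsOrbit X (Neighbours C)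

DiagNeighbourTransitive : ∀ {m q} → Code m q → Set₁
DiagNeighbourTransitive {m} {q} C =
  Σ (DiagSubgroup m q) λ X → NeighbourTransitive X C

αperm : ∀ {q} → Sym q → Vertex q q
αperm t = tabulate λ i → t ⟨$⟩ʳ i

CT : ∀ {q} → Subgroup q → Code q q
CT {q} T β = Σ (Sym q) λ t → mem T t × β ≡ αperm t

rep : ∀ {q} p → Vertex q q → Vertex (p * q) q
rep p α = concat (replicate p α)

Rep : ∀ {q} p → Code q q → Code (p * q) q
Rep {q} p C β = Σ (Vertex q q) λ α → C α × β ≡ rep p α

count : ∀ {m q} → Fin q → Vertex m q → ℕ
count a [] = 0
count a (x ∷ xs) with a ≟ x
... | yes _ = suc (count a xs)
... | no  _ = count a xs

FrequencyPermutationArray : ∀ {q} p → Code (p * q) q → Set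
FrequencyPermutationArray {q} p C = ∀ β → C β → ∀ (a : Fin q) → count a β ≡ p

-- Take X to be the stabiliser of the code in Diag(S_q) × S_m.  An element
-- (h , σ) sends α(s) to α(σ⁻¹ s h), so for x ∈ N(T) and t ∈ T the element
-- (x t , x) stabilises C(T) and sends α(1) to α(t).  Every neighbour is α(t)
-- with some entry i changed to some v ≠ i^t, and (x t , x) maps the neighbour
-- "α(1) with entry 1 changed to 2" to it whenever x maps 1 ↦ i and
-- 2 ↦ v^(t⁻¹), which 2-transitivity of N(T) provides.  Conversely every
-- element of X normalises T, as it maps α(1) and α(s) into C(T); and in α(1)
-- with entry a changed to b the letter a is missing while b occurs twice, so
-- an element of X mapping this word to the one for (c , d) has h : a ↦ c,
-- b ↦ d.  For Rep_p the same elements act blockwise, composed with a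
-- permutation of the blocks that moves the changed entry into any block.
module Submission where

open import Defs
open import Data.Nat using (ℕ; zero; suc; pred; _+_; _*_; _≤_; s≤s; z≤n)
open import Data.Nat.Properties using (*-identityʳ)
open import Data.Fin using (Fin; zero; suc; _≟_; combine)
open import Data.Fin.Properties using (*↔×; remQuot-combine; combine-surjective)
  renaming (suc-injective to fsuc-injective)
open import Data.Fin.Permutation
  using (_⟨$⟩ʳ_; _⟨$⟩ˡ_; _∘ₚ_; flip; id; inverseˡ; inverseʳ; transpose)
open import Data.Product using (Σ; _×_; _,_; proj₁; uncurry; map)
open import Data.Product.Function.NonDependent.Propositional using (_×-↔_)
open import Data.Vec using (Vec; []; _∷_; lookup; tabulate; replicate; _++_; _[_]≔_)
open import Data.Vec.Properties
  using (lookup∘tabulate; tabulate∘lookup; tabulate-cong; lookup∘update; lookup∘update′;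
         lookup-concat; lookup-replicate; []≔-++-↑ˡ; ++-injectiveˡ)
open import Data.Empty using (⊥-elim)
open import Function using (_∘_)
open import Function.Bundles using (_⇔_; mk⇔; Equivalence; Injection)
open import Function.Construct.Composition using (_↔-∘_)
open import Function.Construct.Symmetry using (↔-sym)
open import Function.Properties.Inverse using (↔⇒↣)
open import Relation.Binary.PropositionalEquality
open import Relation.Nullary using (¬_; Dec; yes; no)
open import Relation.Unary using (_⊆_)
open Equivalence
open ≡-Reasoning

private variable
  m q : ℕ

perm-injective : (π : Sym q) {i j : Fin q} → π ⟨$⟩ʳ i ≡ π ⟨$⟩ʳ j → i ≡ j
perm-injective π = Injection.injective (↔⇒↣ π)

≈ₚ⇒≡ˡ : ∀ (σ σ′ : Sym q) → σ ≈ₚ σ′ → ∀ k → σ ⟨$⟩ˡ k ≡ σ′ ⟨$⟩ˡ k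
≈ₚ⇒≡ˡ σ σ′ σ≈σ′ k = begin
  σ ⟨$⟩ˡ k                      ≡⟨ cong (σ ⟨$⟩ˡ_) (inverseʳ σ′) ⟨
  σ ⟨$⟩ˡ (σ′ ⟨$⟩ʳ (σ′ ⟨$⟩ˡ k))  ≡⟨ cong (σ ⟨$⟩ˡ_) (σ≈σ′ _) ⟨
  σ ⟨$⟩ˡ (σ ⟨$⟩ʳ (σ′ ⟨$⟩ˡ k))   ≡⟨ inverseˡ σ ⟩
  σ′ ⟨$⟩ˡ k                     ∎

lookup-ext : ∀ {A : Set} {n} {u v : Vec A n} → (∀ k → lookup u k ≡ lookup v k) → u ≡ v
lookup-ext {u = u} {v} u≗v =
  trans (sym (tabulate∘lookup u)) (trans (tabulate-cong u≗v) (tabulate∘lookup v))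

-- The action of Diag(S_q) × S_m on H(m,q)

lookup-act : ∀ (h : Sym q) (σ : Sym m) α k →
             lookup (act (h , σ) α) k ≡ h ⟨$⟩ʳ lookup α (σ ⟨$⟩ˡ k)
lookup-act h σ α k = lookup∘tabulate _ k

lookup-act-image : ∀ (h : Sym q) (σ : Sym m) α i →
                   lookup (act (h , σ) α) (σ ⟨$⟩ʳ i) ≡ h ⟨$⟩ʳ lookup α i
lookup-act-image h σ α i =
  trans (lookup-act h σ α _) (cong (λ j → h ⟨$⟩ʳ lookup α j) (inverseˡ σ))

act-∘ : ∀ (h h′ : Sym q) (σ σ′ : Sym m) α →
        act (h ∘ₚ h′ , σ ∘ₚ σ′) α ≡ act (h′ , σ′) (act (h , σ) α)
act-∘ h h′ σ σ′ α = lookup-ext λ k → begin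
  lookup (act (h ∘ₚ h′ , σ ∘ₚ σ′) α) k            ≡⟨ lookup-act (h ∘ₚ h′) (σ ∘ₚ σ′) α k ⟩
  h′ ⟨$⟩ʳ (h ⟨$⟩ʳ lookup α (σ ⟨$⟩ˡ (σ′ ⟨$⟩ˡ k)))   ≡⟨ cong (h′ ⟨$⟩ʳ_) (lookup-act h σ α _) ⟨
  h′ ⟨$⟩ʳ lookup (act (h , σ) α) (σ′ ⟨$⟩ˡ k)       ≡⟨ lookup-act h′ σ′ (act (h , σ) α) k ⟨
  lookup (act (h′ , σ′) (act (h , σ) α)) k        ∎

act-id : (α : Vertex m q) → act (id , id) α ≡ α
act-id α = lookup-ext (lookup-act id id α)

act-cong : ∀ (g g′ : DiagL m q) → g ≈d g′ → ∀ α → act g α ≡ act g′ α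
act-cong (h , σ) (h′ , σ′) (h≈h′ , σ≈σ′) α = lookup-ext λ k → begin
  lookup (act (h , σ) α) k     ≡⟨ lookup-act h σ α k ⟩
  h ⟨$⟩ʳ lookup α (σ ⟨$⟩ˡ k)    ≡⟨ h≈h′ _ ⟩
  h′ ⟨$⟩ʳ lookup α (σ ⟨$⟩ˡ k)   ≡⟨ cong (λ j → h′ ⟨$⟩ʳ lookup α j) (≈ₚ⇒≡ˡ σ σ′ σ≈σ′ k) ⟩
  h′ ⟨$⟩ʳ lookup α (σ′ ⟨$⟩ˡ k)  ≡⟨ lookup-act h′ σ′ α k ⟨
  lookup (act (h′ , σ′) α) k   ∎

act-flip : ∀ (h : Sym q) (σ : Sym m) α → act (flip h , flip σ) (act (h , σ) α) ≡ α
act-flip h σ α = begin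
  act (flip h , flip σ) (act (h , σ) α)
    ≡⟨ act-∘ h (flip h) σ (flip σ) α ⟨
  act (h ∘ₚ flip h , σ ∘ₚ flip σ) α
    ≡⟨ act-cong (h ∘ₚ flip h , σ ∘ₚ flip σ) (id , id) ((λ _ → inverseˡ h) , (λ _ → inverseˡ σ)) α ⟩
  act (id , id) α
    ≡⟨ act-id α ⟩
  α ∎

act-update : ∀ (h : Sym q) (σ : Sym m) γ i v →
             act (h , σ) (γ [ i ]≔ v) ≡ act (h , σ) γ [ σ ⟨$⟩ʳ i ]≔ (h ⟨$⟩ʳ v)
act-update h σ γ i v =
  lookup-ext λ k → trans (lookup-act h σ (γ [ i ]≔ v) k) (entry k (k ≟ σ ⟨$⟩ʳ i))
  where
  entry : ∀ k → Dec (k ≡ σ ⟨$⟩ʳ i) →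
          h ⟨$⟩ʳ lookup (γ [ i ]≔ v) (σ ⟨$⟩ˡ k) ≡ lookup (act (h , σ) γ [ σ ⟨$⟩ʳ i ]≔ (h ⟨$⟩ʳ v)) k
  entry _ (yes refl) = begin
    h ⟨$⟩ʳ lookup (γ [ i ]≔ v) (σ ⟨$⟩ˡ (σ ⟨$⟩ʳ i))
      ≡⟨ cong (λ j → h ⟨$⟩ʳ lookup (γ [ i ]≔ v) j) (inverseˡ σ) ⟩
    h ⟨$⟩ʳ lookup (γ [ i ]≔ v) i
      ≡⟨ cong (h ⟨$⟩ʳ_) (lookup∘update i γ v) ⟩
    h ⟨$⟩ʳ v
      ≡⟨ lookup∘update (σ ⟨$⟩ʳ i) (act (h , σ) γ) (h ⟨$⟩ʳ v) ⟨
    lookup (act (h , σ) γ [ σ ⟨$⟩ʳ i ]≔ (h ⟨$⟩ʳ v)) (σ ⟨$⟩ʳ i) ∎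
  entry k (no k≢σi) = begin
    h ⟨$⟩ʳ lookup (γ [ i ]≔ v) (σ ⟨$⟩ˡ k)  ≡⟨ cong (h ⟨$⟩ʳ_) (lookup∘update′ σ⁻¹k≢i γ v) ⟩
    h ⟨$⟩ʳ lookup γ (σ ⟨$⟩ˡ k)              ≡⟨ lookup-act h σ γ k ⟨
    lookup (act (h , σ) γ) k               ≡⟨ lookup∘update′ k≢σi (act (h , σ) γ) (h ⟨$⟩ʳ v) ⟨
    lookup (act (h , σ) γ [ σ ⟨$⟩ʳ i ]≔ (h ⟨$⟩ʳ v)) k ∎
    where
    σ⁻¹k≢i : σ ⟨$⟩ˡ k ≢ i
    σ⁻¹k≢i e = k≢σi (trans (sym (inverseʳ σ)) (cong (σ ⟨$⟩ʳ_) e))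

-- Stabilisers and their orbits

Stabilises : Code m q → DiagL m q → Set
Stabilises C g = ∀ β → C β ⇔ C (act g β)

Preserves : Code m q → DiagL m q → Set
Preserves C g = ∀ β → C β → C (act g β)

preserves⇒stabilises : ∀ (C : Code m q) h σ →
                       Preserves C (h , σ) → Preserves C (flip h , flip σ) → Stabilises C (h , σ)
preserves⇒stabilises C h σ pres pres⁻¹ β =
  mk⇔ (pres β) (λ Cgβ → subst C (act-flip h σ β) (pres⁻¹ (act (h , σ) β) Cgβ))

stabiliser : Code m q → DiagSubgroup m q
stabiliser C = record
  { dmem      = Stabilises C
  ; drespects = λ {g} {g′} g≈g′ stab β →
      let gβ≡g′β = act-cong g g′ g≈g′ β
      in mk⇔ (subst C gβ≡g′β ∘ to (stab β)) (from (stab β) ∘ subst C (sym gβ≡g′β))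
  ; did-mem   = λ β → mk⇔ (subst C (sym (act-id β))) (subst C (act-id β))
  ; d∘-mem    = λ {h} {σ} {h′} {σ′} stab stab′ β →
      mk⇔ (λ Cβ → subst C (sym (act-∘ h h′ σ σ′ β)) (to (stab′ _) (to (stab β) Cβ)))
          (λ Cgβ → from (stab β) (from (stab′ _) (subst C (act-∘ h h′ σ σ′ β) Cgβ)))
  ; dinv-mem  = λ {h} {σ} stab β →
      mk⇔ (λ Cβ → from (stab _) (subst C (sym (act-flip (flip h) (flip σ) β)) Cβ))
          (λ Cgβ → subst C (act-flip (flip h) (flip σ) β) (to (stab _) Cgβ))
  }

StabOrbit : Code m q → Vertex m q → Code m q
StabOrbit {m} {q} C b β = Σ (DiagL m q) λ g → Stabilises C g × β ≡ act g b

stabiliser-orbit : (C P : Code m q) {b : Vertex m q} →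
                   (∀ {g} α → Stabilises C g → P α → P (act g α)) →
                   P b → P ⊆ StabOrbit C b → IsOrbit (stabiliser C) P
stabiliser-orbit C P {b} closed Pb P⊆orbit =
  (b , Pb) , λ α β Pα → mk⇔ (connect Pα) (λ { (g , stab , refl) → closed {g} α stab Pα })
  where
  connect : ∀ {α β} → P α → P β → Σ _ λ g → Stabilises C g × β ≡ act g α
  connect {α} {β} Pα Pβ with P⊆orbit Pα | P⊆orbit Pβ
  ... | (h , σ) , stab , refl | (h′ , σ′) , stab′ , refl =
    (flip h ∘ₚ h′ , flip σ ∘ₚ σ′) ,
    d∘-mem (stabiliser C) {flip h} {flip σ} {h′} {σ′} (dinv-mem (stabiliser C) {h} {σ} stab) stab′ ,
    (begin
      act (h′ , σ′) b
        ≡⟨ cong (act (h′ , σ′)) (act-flip h σ b) ⟨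
      act (h′ , σ′) (act (flip h , flip σ) (act (h , σ) b))
        ≡⟨ act-∘ (flip h) h′ (flip σ) σ′ (act (h , σ) b) ⟨
      act (flip h ∘ₚ h′ , flip σ ∘ₚ σ′) (act (h , σ) b) ∎)

-- Adjacency is changing a single entry

dist-refl : (α : Vertex m q) → dist α α ≡ 0
dist-refl [] = refl
dist-refl (x ∷ xs) with x ≟ x
... | yes _  = dist-refl xs
... | no x≢x = ⊥-elim (x≢x refl)

dist≡0⇒≡ : (α β : Vertex m q) → dist α β ≡ 0 → α ≡ β
dist≡0⇒≡ [] [] _ = refl
dist≡0⇒≡ (x ∷ xs) (y ∷ ys) d≡0 with x ≟ y | d≡0
... | yes refl | xs≈ys = cong (x ∷_) (dist≡0⇒≡ xs ys xs≈ys)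
... | no _     | ()

adjacent⇒update : (γ β : Vertex m q) → Adjacent γ β →
                  Σ (Fin m × Fin q) λ (i , v) → lookup γ i ≢ v × β ≡ γ [ i ]≔ v
adjacent⇒update [] [] ()
adjacent⇒update (x ∷ xs) (y ∷ ys) d≡1 with x ≟ y
... | yes refl = let (i , v) , xsᵢ≢v , ys≡ = adjacent⇒update xs ys d≡1
                 in (suc i , v) , xsᵢ≢v , cong (x ∷_) ys≡
... | no x≢y   = (zero , y) , x≢y , cong (y ∷_) (sym (dist≡0⇒≡ xs ys (cong pred d≡1)))

update⇒adjacent : (γ : Vertex m q) (i : Fin m) (v : Fin q) → lookup γ i ≢ v → Adjacent γ (γ [ i ]≔ v)
update⇒adjacent (x ∷ xs) zero v x≢v with x ≟ v
... | yes x≡v = ⊥-elim (x≢v x≡v)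
... | no _    = cong suc (dist-refl xs)
update⇒adjacent (x ∷ xs) (suc i) v xsᵢ≢v with x ≟ x
... | yes _  = update⇒adjacent xs i v xsᵢ≢v
... | no x≢x = ⊥-elim (x≢x refl)

adjacent-act : ∀ (h : Sym q) (σ : Sym m) γ β → Adjacent γ β → Adjacent (act (h , σ) γ) (act (h , σ) β)
adjacent-act h σ γ β adj with adjacent⇒update γ β adj
... | (i , v) , γᵢ≢v , refl =
  subst (Adjacent (act (h , σ) γ)) (sym (act-update h σ γ i _))
    (update⇒adjacent (act (h , σ) γ) (σ ⟨$⟩ʳ i) (h ⟨$⟩ʳ v)
      (λ e → γᵢ≢v (perm-injective h (trans (sym (lookup-act-image h σ γ i)) e))))

neighbours-stable : ∀ (C : Code m q) {g} β → Stabilises C g → Neighbours C β → Neighbours C (act g β)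
neighbours-stable C {h , σ} β stab (β∉C , γ , Cγ , adj) =
  (λ Cgβ → β∉C (from (stab β) Cgβ)) , act (h , σ) γ , to (stab γ) Cγ , adjacent-act h σ γ β adj

-- The stabiliser of C is transitive on C and on the arcs (γ , γ [ i ]≔ v)
-- from codewords γ, an arc being recorded by (γ , i , v); the head of the
-- base arc lies outside C.
record ArcTransitive (C : Code m q) (γ₀ : Vertex m q) (i₀ : Fin m) (v₀ : Fin q) : Set where
  field
    base∈C       : C γ₀
    base-changes : lookup γ₀ i₀ ≢ v₀
    base-arc∉C   : ¬ C (γ₀ [ i₀ ]≔ v₀)
    codewords    : C ⊆ StabOrbit C γ₀
    arcs         : ∀ {γ i v} → C γ → lookup γ i ≢ v →
                   Σ (DiagL m q) λ (h , σ) →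
                     Stabilises C (h , σ) × act (h , σ) γ₀ ≡ γ × σ ⟨$⟩ʳ i₀ ≡ i × h ⟨$⟩ʳ v₀ ≡ v

arcTransitive⇒DNT : ∀ {C : Code m q} {γ₀ i₀ v₀} → ArcTransitive C γ₀ i₀ v₀ → DiagNeighbourTransitive C
arcTransitive⇒DNT {C = C} {γ₀} {i₀} {v₀} arcT =
  stabiliser C ,
  stabiliser-orbit C C (λ α stab Cα → to (stab α) Cα) base∈C codewords ,
  stabiliser-orbit C (Neighbours C) (λ {g} → neighbours-stable C {g}) base-neighbour neighbours
  where
  open ArcTransitive arcT
  base-neighbour : Neighbours C (γ₀ [ i₀ ]≔ v₀)
  base-neighbour = base-arc∉C , γ₀ , base∈C , update⇒adjacent γ₀ i₀ v₀ base-changes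
  neighbours : Neighbours C ⊆ StabOrbit C (γ₀ [ i₀ ]≔ v₀)
  neighbours {β} (_ , γ , Cγ , adj) with adjacent⇒update γ β adj
  ... | (i , v) , γᵢ≢v , refl with arcs Cγ γᵢ≢v
  ...   | (h , σ) , stab , refl , refl , refl = (h , σ) , stab , sym (act-update h σ γ₀ i₀ v₀)

-- Permutation codes

lookup-αperm : (t : Sym q) (k : Fin q) → lookup (αperm t) k ≡ t ⟨$⟩ʳ k
lookup-αperm t k = lookup∘tabulate _ k

αperm-injective : {t u : Sym q} → αperm t ≡ αperm u → t ≈ₚ u
αperm-injective {t = t} {u} e k =
  trans (sym (lookup-αperm t k)) (trans (cong (λ w → lookup w k) e) (lookup-αperm u k))

act-αperm : ∀ (h σ s : Sym q) → act (h , σ) (αperm s) ≡ αperm (flip σ ∘ₚ (s ∘ₚ h))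
act-αperm h σ s = lookup-ext λ k → begin
  lookup (act (h , σ) (αperm s)) k      ≡⟨ lookup-act h σ (αperm s) k ⟩
  h ⟨$⟩ʳ lookup (αperm s) (σ ⟨$⟩ˡ k)    ≡⟨ cong (h ⟨$⟩ʳ_) (lookup-αperm s _) ⟩
  h ⟨$⟩ʳ (s ⟨$⟩ʳ (σ ⟨$⟩ˡ k))            ≡⟨ lookup-αperm (flip σ ∘ₚ (s ∘ₚ h)) k ⟨
  lookup (αperm (flip σ ∘ₚ (s ∘ₚ h))) k ∎

module _ (T : Subgroup q) where

  αperm∈CT⇒mem : ∀ {u} → CT T (αperm u) → mem T u
  αperm∈CT⇒mem {u} (t , t∈T , e) = respects T (αperm-injective {t = t} {u} (sym e)) t∈T

  -- σ⁻¹ T h ⊆ T gives u₀ = σ⁻¹ h ∈ T, and then h⁻¹ s h = u₀⁻¹ (σ⁻¹ s h).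
  coset-closed⇒conj-closed : ∀ (h σ : Sym q) → (∀ {s} → mem T s → mem T (flip σ ∘ₚ (s ∘ₚ h))) →
                             ∀ {s} → mem T s → mem T (conj h s)
  coset-closed⇒conj-closed h σ closed {s} s∈T =
    respects T (λ _ → cong (λ j → h ⟨$⟩ʳ (s ⟨$⟩ʳ j)) (inverseˡ σ))
      (∘-mem T (inv-mem T (closed (id-mem T))) (closed s∈T))

  conj-closed⇒normaliser : ∀ (h : Sym q) → (∀ {s} → mem T s → mem T (conj h s)) →
                           (∀ {s} → mem T s → mem T (conj (flip h) s)) → Normaliser T h
  conj-closed⇒normaliser h closed closed⁻¹ s =
    mk⇔ closed (respects T (λ _ → trans (inverseˡ h) (cong (s ⟨$⟩ʳ_) (inverseˡ h))) ∘ closed⁻¹)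

  normaliser-flip : ∀ (x : Sym q) → Normaliser T x → ∀ {s} → mem T s → mem T (conj (flip x) s)
  normaliser-flip x x∈N {s} s∈T =
    from (x∈N (conj (flip x) s))
      (respects T (λ _ → sym (trans (inverseʳ x) (cong (s ⟨$⟩ʳ_) (inverseʳ x)))) s∈T)

  id∈normaliser : Normaliser T id
  id∈normaliser s = mk⇔ (respects T (λ _ → refl)) (respects T (λ _ → refl))

  preserves-CT : ∀ (h σ : Sym q) → (∀ {s} → mem T s → mem T (flip σ ∘ₚ (s ∘ₚ h))) →
                 Preserves (CT T) (h , σ)
  preserves-CT h σ closed _ (s , s∈T , refl) = _ , closed s∈T , act-αperm h σ s

  normaliser-stabilises-CT : ∀ (x t : Sym q) → Normaliser T x → mem T t →
                             Stabilises (CT T) (x ∘ₚ t , x)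
  normaliser-stabilises-CT x t x∈N t∈T = preserves⇒stabilises (CT T) (x ∘ₚ t) x
    (preserves-CT (x ∘ₚ t) x λ s∈T → respects T (λ _ → refl) (∘-mem T (to (x∈N _) s∈T) t∈T))
    (preserves-CT (flip (x ∘ₚ t)) (flip x) λ s∈T →
       respects T (λ _ → refl) (normaliser-flip x x∈N (∘-mem T s∈T (inv-mem T t∈T))))

  act-αperm-id : ∀ (x t : Sym q) → act (x ∘ₚ t , x) (αperm id) ≡ αperm t
  act-αperm-id x t =
    trans (act-αperm (x ∘ₚ t) x id) (tabulate-cong λ k → cong (t ⟨$⟩ʳ_) (inverseʳ x))

  stabiliser-normalises : ∀ (X : DiagSubgroup q q) → IsOrbit X (CT T) →
                          ∀ {h σ} → dmem X (h , σ) → Normaliser T h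
  stabiliser-normalises X (_ , orbit) {h} {σ} g∈X =
    conj-closed⇒normaliser h (coset-closed⇒conj-closed h σ (closed g∈X))
                             (coset-closed⇒conj-closed (flip h) (flip σ) (closed (dinv-mem X g∈X)))
    where
    closed : ∀ {h σ} → dmem X (h , σ) → ∀ {s} → mem T s → mem T (flip σ ∘ₚ (s ∘ₚ h))
    closed {h} {σ} g∈X {s} s∈T = αperm∈CT⇒mem
      (subst (CT T) (act-αperm h σ s) (from (orbit _ _ (s , s∈T , refl)) ((h , σ) , g∈X , refl)))

lookup-id-update : ∀ (a b k : Fin q) → k ≢ a → lookup (αperm id [ a ]≔ b) k ≡ k
lookup-id-update a b k k≢a = trans (lookup∘update′ k≢a (αperm id) b) (lookup-αperm id k)

id-update-misses : ∀ (a b : Fin q) → a ≢ b → ∀ y → lookup (αperm id [ a ]≔ b) y ≢ a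
id-update-misses a b a≢b y with y ≟ a
... | yes refl = λ b≡a → a≢b (sym (trans (sym (lookup∘update a (αperm id) b)) b≡a))
... | no y≢a   = λ yᵢ≡a → y≢a (trans (sym (lookup-id-update a b y y≢a)) yᵢ≡a)

id-update-misses-only : ∀ (c d v : Fin q) → (∀ y → lookup (αperm id [ c ]≔ d) y ≢ v) → v ≡ c
id-update-misses-only c d v misses with v ≟ c
... | yes v≡c = v≡c
... | no v≢c  = ⊥-elim (misses v (lookup-id-update c d v v≢c))

id-update-repeats-only : ∀ (c d k₁ k₂ v : Fin q) → k₁ ≢ k₂ →
                         lookup (αperm id [ c ]≔ d) k₁ ≡ v → lookup (αperm id [ c ]≔ d) k₂ ≡ v → v ≡ d
id-update-repeats-only c d k₁ k₂ v k₁≢k₂ e₁ e₂ with k₁ ≟ c | k₂ ≟ c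
... | yes refl | _        = trans (sym e₁) (lookup∘update c (αperm id) d)
... | no _     | yes refl = trans (sym e₂) (lookup∘update c (αperm id) d)
... | no k₁≢c  | no k₂≢c  = ⊥-elim (k₁≢k₂ (begin
  k₁                             ≡⟨ lookup-id-update c d k₁ k₁≢c ⟨
  lookup (αperm id [ c ]≔ d) k₁  ≡⟨ trans e₁ (sym e₂) ⟩
  lookup (αperm id [ c ]≔ d) k₂  ≡⟨ lookup-id-update c d k₂ k₂≢c ⟩
  k₂                             ∎))

id-update-neighbour : ∀ (T : Subgroup q) (a b : Fin q) → a ≢ b → Neighbours (CT T) (αperm id [ a ]≔ b)
id-update-neighbour T a b a≢b =
  not-codeword , αperm id , (id , id-mem T , refl) ,
  update⇒adjacent (αperm id) a b (λ aᵢ≡b → a≢b (trans (sym (lookup-αperm id a)) aᵢ≡b))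
  where
  not-codeword : ¬ CT T (αperm id [ a ]≔ b)
  not-codeword (s , _ , e) = a≢b (perm-injective s (begin
    s ⟨$⟩ʳ a                         ≡⟨ lookup-αperm s a ⟨
    lookup (αperm s) a               ≡⟨ cong (λ w → lookup w a) e ⟨
    lookup (αperm id [ a ]≔ b) a     ≡⟨ lookup∘update a (αperm id) b ⟩
    b                                ≡⟨ lookup-id-update a b b (a≢b ∘ sym) ⟨
    lookup (αperm id [ a ]≔ b) b     ≡⟨ cong (λ w → lookup w b) e ⟩
    lookup (αperm s) b               ≡⟨ lookup-αperm s b ⟩
    s ⟨$⟩ʳ b                         ∎))

DNT⇒normaliser-2-transitive : ∀ (T : Subgroup q) → DiagNeighbourTransitive (CT T) →
                              TwoTransitive (Normaliser T)
DNT⇒normaliser-2-transitive T (X , orbitC , _ , orbitN) a b c d a≢b c≢d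
  with to (orbitN _ _ (id-update-neighbour T a b a≢b)) (id-update-neighbour T c d c≢d)
... | (h , σ) , g∈X , target≡ =
  h , stabiliser-normalises T X orbitC g∈X ,
  id-update-misses-only c d (h ⟨$⟩ʳ a) misses ,
  id-update-repeats-only c d (σ ⟨$⟩ʳ a) (σ ⟨$⟩ʳ b) (h ⟨$⟩ʳ b) (a≢b ∘ perm-injective σ)
    (moves a (lookup∘update a (αperm id) b)) (moves b (lookup-id-update a b b (a≢b ∘ sym)))
  where
  source target : Vertex _ _
  source = αperm id [ a ]≔ b
  target = αperm id [ c ]≔ d
  moves : ∀ k → lookup source k ≡ b → lookup target (σ ⟨$⟩ʳ k) ≡ h ⟨$⟩ʳ b
  moves k e = begin
    lookup target (σ ⟨$⟩ʳ k)                ≡⟨ cong (λ w → lookup w (σ ⟨$⟩ʳ k)) target≡ ⟩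
    lookup (act (h , σ) source) (σ ⟨$⟩ʳ k)  ≡⟨ lookup-act-image h σ source k ⟩
    h ⟨$⟩ʳ lookup source k                  ≡⟨ cong (h ⟨$⟩ʳ_) e ⟩
    h ⟨$⟩ʳ b                                ∎
  misses : ∀ y → lookup target y ≢ h ⟨$⟩ʳ a
  misses y e = id-update-misses a b a≢b (σ ⟨$⟩ˡ y) (perm-injective h (begin
    h ⟨$⟩ʳ lookup source (σ ⟨$⟩ˡ y)  ≡⟨ lookup-act h σ source y ⟨
    lookup (act (h , σ) source) y    ≡⟨ cong (λ w → lookup w y) target≡ ⟨
    lookup target y                  ≡⟨ e ⟩
    h ⟨$⟩ʳ a                         ∎))

arcTransitive-CT : ∀ {r} (T : Subgroup (2 + r)) → TwoTransitive (Normaliser T) →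
                   ArcTransitive (CT T) (αperm id) zero (suc zero)
arcTransitive-CT T twoT = record
  { base∈C       = id , id-mem T , refl
  ; base-changes = λ ()
  ; base-arc∉C   = proj₁ (id-update-neighbour T zero (suc zero) (λ ()))
  ; codewords    = λ { (t , t∈T , refl) →
      (id ∘ₚ t , id) , normaliser-stabilises-CT T id t (id∈normaliser T) t∈T ,
      sym (act-αperm-id T id t) }
  ; arcs         = arc
  }
  where
  arc : ∀ {γ i v} → CT T γ → lookup γ i ≢ v →
        Σ (DiagL _ _) λ (h , σ) → Stabilises (CT T) (h , σ) ×
          act (h , σ) (αperm id) ≡ γ × σ ⟨$⟩ʳ zero ≡ i × h ⟨$⟩ʳ suc zero ≡ v
  arc {i = i} {v} (t , t∈T , refl) tᵢ≢v
    with twoT zero (suc zero) i (t ⟨$⟩ˡ v) (λ ())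
           (λ i≡t⁻¹v → tᵢ≢v (trans (lookup-αperm t i) (trans (cong (t ⟨$⟩ʳ_) i≡t⁻¹v) (inverseʳ t))))
  ... | x , x∈N , x0≡i , x1≡t⁻¹v =
    (x ∘ₚ t , x) , normaliser-stabilises-CT T x t x∈N t∈T , act-αperm-id T x t , x0≡i ,
    trans (cong (t ⟨$⟩ʳ_) x1≡t⁻¹v) (inverseʳ t)

-- Repetition codes

-- σ acting inside each block and π permuting the blocks; position
-- combine b k is entry k of block b.
blockPerm : ∀ {p} → Sym p → Sym q → Sym (p * q)
blockPerm π σ = ↔-sym *↔× ↔-∘ ((π ×-↔ σ) ↔-∘ *↔×)

blockPerm-combine : ∀ {p} (π : Sym p) (σ : Sym q) b k →
                    blockPerm π σ ⟨$⟩ʳ combine b k ≡ combine (π ⟨$⟩ʳ b) (σ ⟨$⟩ʳ k)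
blockPerm-combine π σ b k = cong (uncurry combine ∘ map (π ⟨$⟩ʳ_) (σ ⟨$⟩ʳ_)) (remQuot-combine b k)

blockPerm⁻¹-combine : ∀ {p} (π : Sym p) (σ : Sym q) b k →
                      blockPerm π σ ⟨$⟩ˡ combine b k ≡ combine (π ⟨$⟩ˡ b) (σ ⟨$⟩ˡ k)
blockPerm⁻¹-combine π σ b k = cong (uncurry combine ∘ map (π ⟨$⟩ˡ_) (σ ⟨$⟩ˡ_)) (remQuot-combine b k)

lookup-rep : ∀ p (α : Vertex q q) b k → lookup (rep p α) (combine b k) ≡ lookup α k
lookup-rep p α b k =
  trans (lookup-concat (replicate p α) b k) (cong (λ w → lookup w k) (lookup-replicate b α))

combine-ext : ∀ {A : Set} {p} {u v : Vec A (p * q)} →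
              (∀ b k → lookup u (combine b k) ≡ lookup v (combine b k)) → u ≡ v
combine-ext {q = q} {p = p} {u} {v} u≗v = lookup-ext λ P →
  let b , k , e = combine-surjective {p} {q} P in subst (λ P → lookup u P ≡ lookup v P) e (u≗v b k)

act-rep : ∀ {p} (h σ : Sym q) (π : Sym p) α → act (h , blockPerm π σ) (rep p α) ≡ rep p (act (h , σ) α)
act-rep {p = p} h σ π α = combine-ext λ b k → begin
  lookup (act (h , blockPerm π σ) (rep p α)) (combine b k)
    ≡⟨ lookup-act h (blockPerm π σ) (rep p α) (combine b k) ⟩
  h ⟨$⟩ʳ lookup (rep p α) (blockPerm π σ ⟨$⟩ˡ combine b k)
    ≡⟨ cong (λ P → h ⟨$⟩ʳ lookup (rep p α) P) (blockPerm⁻¹-combine π σ b k) ⟩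
  h ⟨$⟩ʳ lookup (rep p α) (combine (π ⟨$⟩ˡ b) (σ ⟨$⟩ˡ k))
    ≡⟨ cong (h ⟨$⟩ʳ_) (lookup-rep p α (π ⟨$⟩ˡ b) (σ ⟨$⟩ˡ k)) ⟩
  h ⟨$⟩ʳ lookup α (σ ⟨$⟩ˡ k)
    ≡⟨ lookup-act h σ α k ⟨
  lookup (act (h , σ) α) k
    ≡⟨ lookup-rep p (act (h , σ) α) b k ⟨
  lookup (rep p (act (h , σ) α)) (combine b k) ∎

preserves-Rep : ∀ {p} (C : Code q q) (h σ : Sym q) (π : Sym p) →
                Preserves C (h , σ) → Preserves (Rep p C) (h , blockPerm π σ)
preserves-Rep C h σ π pres _ (α , Cα , refl) = act (h , σ) α , pres α Cα , act-rep h σ π α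

stabilises-Rep : ∀ {p} (C : Code q q) (h σ : Sym q) (π : Sym p) →
                 Stabilises C (h , σ) → Stabilises (Rep p C) (h , blockPerm π σ)
stabilises-Rep {p = p} C h σ π stab = preserves⇒stabilises (Rep p C) h (blockPerm π σ)
  (preserves-Rep C h σ π (λ β → to (stab β)))
  (preserves-Rep C (flip h) (flip σ) (flip π) (λ β → to (dinv-mem (stabiliser C) {h} {σ} stab β)))

arcTransitive-Rep : ∀ {p} {C : Code q q} {γ₀ i₀ v₀} → ArcTransitive C γ₀ i₀ v₀ →
                    ArcTransitive (Rep (suc p) C) (rep (suc p) γ₀) (combine {suc p} zero i₀) v₀
arcTransitive-Rep {q = q} {p} {C} {γ₀} {i₀} {v₀} arcT = record
  { base∈C       = γ₀ , base∈C , refl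
  ; base-changes = base-changes ∘ trans (sym (lookup-rep (suc p) γ₀ zero i₀))
  ; base-arc∉C   = λ (α , Cα , e) →
      base-arc∉C (subst C (sym (++-injectiveˡ _ α (trans (sym ([]≔-++-↑ˡ γ₀ (rep p γ₀) i₀)) e))) Cα)
  ; codewords    = codeword
  ; arcs         = arc
  }
  where
  open ArcTransitive arcT
  codeword : Rep (suc p) C ⊆ StabOrbit (Rep (suc p) C) (rep (suc p) γ₀)
  codeword (α , Cα , refl) with codewords Cα
  ... | (h , σ) , stab , refl =
    (h , blockPerm {p = suc p} id σ) , stabilises-Rep C h σ id stab , sym (act-rep h σ id γ₀)
  arc : ∀ {γ P v} → Rep (suc p) C γ → lookup γ P ≢ v →
        Σ (DiagL _ _) λ (h , σ) → Stabilises (Rep (suc p) C) (h , σ) ×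
          act (h , σ) (rep (suc p) γ₀) ≡ γ × σ ⟨$⟩ʳ combine {suc p} zero i₀ ≡ P × h ⟨$⟩ʳ v₀ ≡ v
  arc {P = P} (α , Cα , refl) αₚ≢v with combine-surjective {suc p} {q} P
  ... | b , i , refl with arcs Cα (αₚ≢v ∘ trans (lookup-rep (suc p) α b i))
  ...   | (h , σ) , stab , refl , refl , h₀≡v =
    (h , blockPerm (transpose zero b) σ) , stabilises-Rep C h σ (transpose zero b) stab ,
    act-rep h σ (transpose zero b) γ₀ , blockPerm-combine (transpose zero b) σ zero i₀ , h₀≡v

-- Letter frequencies

count-absent : ∀ {n} (a : Fin q) (f : Fin n → Fin q) → (∀ i → f i ≢ a) → count a (tabulate f) ≡ 0
count-absent {n = zero}  a f absent = refl
count-absent {n = suc n} a f absent with a ≟ f zero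
... | yes a≡f0 = ⊥-elim (absent zero (sym a≡f0))
... | no _     = count-absent a (f ∘ suc) (absent ∘ suc)

count-unique : ∀ {n} (a : Fin q) (f : Fin n → Fin q) (i₀ : Fin n) →
               f i₀ ≡ a → (∀ i → f i ≡ a → i ≡ i₀) → count a (tabulate f) ≡ 1
count-unique {n = suc n} a f i₀ fi₀≡a unique with a ≟ f zero
... | yes a≡f0 = cong suc (count-absent a (f ∘ suc) λ i fi≡a →
                   suc≢zero (trans (unique (suc i) fi≡a) (sym (unique zero (sym a≡f0)))))
  where
  suc≢zero : ∀ {i : Fin n} → suc i ≢ zero
  suc≢zero ()
count-unique a f zero     fi₀≡a unique | no a≢f0 = ⊥-elim (a≢f0 (sym fi₀≡a))
count-unique a f (suc i₀) fi₀≡a unique | no _    =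
  count-unique a (f ∘ suc) i₀ fi₀≡a (λ i fi≡a → fsuc-injective (unique (suc i) fi≡a))

count-αperm : ∀ (a : Fin q) (t : Sym q) → count a (αperm t) ≡ 1
count-αperm a t = count-unique a (t ⟨$⟩ʳ_) (t ⟨$⟩ˡ a) (inverseʳ t)
  (λ i tᵢ≡a → trans (sym (inverseˡ t)) (cong (t ⟨$⟩ˡ_) tᵢ≡a))

count-++ : ∀ {n₁ n₂} (a : Fin q) (xs : Vec (Fin q) n₁) (ys : Vec (Fin q) n₂) →
           count a (xs ++ ys) ≡ count a xs + count a ys
count-++ a []       ys = refl
count-++ a (x ∷ xs) ys with a ≟ x
... | yes _ = cong suc (count-++ a xs ys)
... | no _  = count-++ a xs ys

count-rep : ∀ (a : Fin q) p (α : Vertex q q) → count a (rep p α) ≡ p * count a α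
count-rep a zero    α = refl
count-rep a (suc p) α = trans (count-++ a α (rep p α)) (cong (count a α +_) (count-rep a p α))

Rep-CT-frequency : ∀ (T : Subgroup q) p → FrequencyPermutationArray p (Rep p (CT T))
Rep-CT-frequency T p _ (_ , (t , _ , refl) , refl) a =
  trans (count-rep a p (αperm t)) (trans (cong (p *_) (count-αperm a t)) (*-identityʳ p))

theorem1p3 : (q : ℕ) → 2 ≤ q → (T : Subgroup q) →
    (DiagNeighbourTransitive (CT T) ⇔ TwoTransitive (Normaliser T)) ×
    ((p : ℕ) → 1 ≤ p → DiagNeighbourTransitive (CT T) →
      FrequencyPermutationArray p (Rep p (CT T)) ×
      DiagNeighbourTransitive (Rep p (CT T)))
theorem1p3 (suc (suc r)) (s≤s (s≤s z≤n)) T =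
  mk⇔ (DNT⇒normaliser-2-transitive T) (arcTransitive⇒DNT ∘ arcTransitive-CT T) ,
  λ { (suc p) (s≤s z≤n) dnt →
        Rep-CT-frequency T (suc p) ,
        arcTransitive⇒DNT (arcTransitive-Rep {p = p}
          (arcTransitive-CT T (DNT⇒normaliser-2-transitive T dnt))) }
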